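{- Let $\mathcal{M}$ be a Turing machine satisfying the assumptions in the context, let $c_0$ be a configuration and let $c_0,c_1,\ldots$ be the sequence of configurations of $\mathcal{M}$ starting from $c_0$. Then for every $n\in\mathbb{N}$, $[c_n]=\operatorname{step}_\mathcal{M}^{[n]}([c_0])$, where $\operatorname{step}_\mathcal{M}^{[n]}$ is the $n$-fold composition of $\operatorname{step}_\mathcal{M}$ (the identity for $n=0$).
   Context: $\mathcal{M}=(Q,\Sigma,b,\delta,q_0,F)$ with $Q=\{0,\ldots,m-1\}$, $\Sigma=\{0,1,\ldots,k-2\}$ for an integer $k\geqslant2$, blank $b=0$, transition function $\delta=(\delta_1,\delta_2,\delta_3):Q\times\Sigma\to Q\times\Sigma\times\{0,1\}$ giving the new state, the written symbol, and the head move ($0$ = left, $1$ = right); final states are absorbing. A configuration is $c=(x,s,y,q)$: $q$ the state, $s$ the symbol under the head, $x=x_0+x_1k+\cdots+x_nk^n$ with $x_i\in\Sigma$ the symbols to the left of the head ($x_0$ adjacent to the head, further cells blank), $y$ similarly for the right side. Rational encoding: $[c]=(0.x,s,0.y,q)$ with $0.x=\sum_i x_ik^{ -i-1}$, similarly $0.y$. For $i=1,2,3$, $L_{\delta_i}:\mathbb{R}^2\to\mathbb{R}$ is a (Lagrange interpolation) polynomial with $L_{\delta_i}(q,s)=\delta_i(q,s)$ for all $(q,s)\in Q\times\Sigma$. Let $\operatorname{int}(x)=\lfloor x\rfloor$, $\operatorname{frac}(x)=x-\lfloor x\rfloor$, and $\operatorname{choose}[a,b]=(1-L_{\delta_3}(q,s))a+L_{\delta_3}(q,s)b$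 (with $q,s$ the current arguments). Then $\operatorname{step}_\mathcal{M}:\mathbb{R}^4\to\mathbb{R}^4$ is \[\operatorname{step}_\mathcal{M}(x,s,y,q)=\Big(\operatorname{choose}\big[\operatorname{frac}(kx),\tfrac{x+L_{\delta_2}(q,s)}{k}\big],\ \operatorname{choose}\big[\operatorname{int}(kx),\operatorname{int}(ky)\big],\ \operatorname{choose}\big[\tfrac{y+L_{\delta_2}(q,s)}{k},\operatorname{frac}(ky)\big],\ L_{\delta_1}(q,s)\Big).\] -}

module Defs where

open import Data.Nat as ℕ using (ℕ; zero; suc)
open import Data.Fin using (Fin; toℕ)
open import Data.Fin.Subset using (Subset; _∈_)
open import Data.Bool using (Bool; true; false)
open import Data.Product using (_×_; _,_; proj₁; proj₂)
open import Data.List using (List; []; _∷_)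
import Data.Integer as ℤ
open import Data.Rational using (ℚ; 0ℚ; 1ℚ; _+_; _-_; _*_; _/_; floor)
open import Relation.Binary.PropositionalEquality using (_≡_)

-- A Turing machine M = (Q, Σ, b, δ, q₀, F) with Q = {0,…,m-1},
-- Σ = {0,…,k-2} where k = j + 2 ≥ 2 (so Σ = Fin (suc j)), blank b = 0,
-- δ = (δ₁, δ₂, δ₃) : Q × Σ → Q × Σ × {0,1}  (false = 0 = left, true = 1 = right),
-- final states absorbing.
record TM : Set where
  field
    m  : ℕ
    j  : ℕ
    δ  : Fin m → Fin (suc j) → Fin m × Fin (suc j) × Bool
    q₀ : Fin m
    F  : Subset m
    absorbing : ∀ q s → q ∈ F → proj₁ (δ q s) ≡ q

  k : ℕ
  k = suc (suc j)

  Σ : Set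
  Σ = Fin (suc j)

  δ₁ : Fin m → Σ → Fin m
  δ₁ q s = proj₁ (δ q s)

  δ₂ : Fin m → Σ → Σ
  δ₂ q s = proj₁ (proj₂ (δ q s))

  δ₃ : Fin m → Σ → Bool
  δ₃ q s = proj₂ (proj₂ (δ q s))

  blank : Σ
  blank = Fin.zero

-- A tape half: the list x₀ ∷ x₁ ∷ … (x₀ adjacent to the head); all further cells blank.
-- A configuration c = (x, s, y, q).
Config : TM → Set
Config M = List Σ × Σ × List Σ × Fin m
  where open TM M

hd : {A : Set} → A → List A → A
hd b []      = b
hd b (a ∷ _) = a

tl : {A : Set} → List A → List A
tl []      = []
tl (_ ∷ l) = l

move : (M : TM) → Bool → Config M → Config M
move M false (x , s , y , q) = tl x , hd (TM.blank M) x , (TM.δ₂ M q s ∷ y) , TM.δ₁ M q s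
move M true  (x , s , y , q) = (TM.δ₂ M q s ∷ x) , hd (TM.blank M) y , tl y , TM.δ₁ M q s

next : (M : TM) → Config M → Config M
next M c@(x , s , y , q) = move M (TM.δ₃ M q s) c

run : (M : TM) → ℕ → Config M → Config M
run M zero    c = c
run M (suc n) c = next M (run M n c)

ℕ→ℚ : ℕ → ℚ
ℕ→ℚ n = ℤ.+ n / 1

Fin→ℚ : {n : ℕ} → Fin n → ℚ
Fin→ℚ i = ℕ→ℚ (toℕ i)

Bool→ℚ : Bool → ℚ
Bool→ℚ false = 0ℚ
Bool→ℚ true  = 1ℚ

-- 0.x = Σ xᵢ k^(-i-1)
frac-enc : (k : ℕ) .{{_ : ℕ.NonZero k}} {A : Set} → (A → ℚ) → List A → ℚ
frac-enc k f []      = 0ℚ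
frac-enc k f (a ∷ l) = (f a + frac-enc k f l) * (ℤ.+ 1 / k)

ℚ⁴ : Set
ℚ⁴ = ℚ × ℚ × ℚ × ℚ

encode : (M : TM) → Config M → ℚ⁴
encode M (x , s , y , q) = frac-enc k Fin→ℚ x , Fin→ℚ s , frac-enc k Fin→ℚ y , Fin→ℚ q
  where open TM M

int : ℚ → ℚ
int p = floor p / 1

frac : ℚ → ℚ
frac p = p - int p

Interpolates : (M : TM) → (ℚ → ℚ → ℚ) → (Fin (TM.m M) → TM.Σ M → ℚ) → Set
Interpolates M L d = ∀ q s → L (Fin→ℚ q) (Fin→ℚ s) ≡ d q s

step : (M : TM) → (L₁ L₂ L₃ : ℚ → ℚ → ℚ) → ℚ⁴ → ℚ⁴
step M L₁ L₂ L₃ (x , s , y , q) =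
    choose (frac (K * x)) ((x + L₂ q s) * (ℤ.+ 1 / k))
  , choose (int (K * x)) (int (K * y))
  , choose ((y + L₂ q s) * (ℤ.+ 1 / k)) (frac (K * y))
  , L₁ q s
  where
    open TM M
    K : ℚ
    K = ℕ→ℚ k
    choose : ℚ → ℚ → ℚ
    choose a b = (1ℚ - L₃ q s) * a + L₃ q s * b

iter : {A : Set} → (A → A) → ℕ → A → A
iter f zero    a = a
iter f (suc n) a = f (iter f n a)

module Submission where

-- The rational encoding turns one move of the machine into one application
-- of step_M, and the theorem follows by induction on n.
--
-- The only non-trivial part is reading off and shifting base-k expansions.
-- For a tape half l with digits below k, the value 0.l lies in [0, 1), and
--   k · 0.(a ∷ l) = a + 0.l ,
-- so int (k · 0.l) is the head digit of l and frac (k · 0.l) = 0.(tail l);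
-- writing a digit d in front of l is (0.l + d) / k.  These facts are proved
-- in the module  Expansion  for an arbitrary radix k, after two preliminary
-- groups of lemmas: the embedding ℕ → ℚ (monotone, k · (1/k) = 1) and a
-- characterisation of floor (floor p = a when a ≤ p < a + 1).
--
-- On the machine side, the weight L₃(q, s) equals 0 or 1, so each  choose
-- in step_M selects one of its two arguments; with the shift facts this
-- gives  step_M [c] = [next c]  (step-simulates-next), and lemma12 is its
-- n-fold iteration.

open import Defs
open import Data.Bool using (Bool; true; false; if_then_else_)
open import Data.Fin using (Fin; toℕ)
import Data.Fin.Properties as Finₚ
open import Data.List using (List; []; _∷_)
open import Data.Nat as ℕ using (ℕ; zero; suc)
import Data.Nat.Properties as ℕₚ
open import Data.Nat.Coprimality using (1-coprimeTo) renaming (sym to coprime-sym)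
open import Data.Nat.DivMod using (m*n/n≡m; /-monoˡ-≤; m<n*o⇒m/o<n)
import Data.Integer as ℤ
import Data.Integer.Properties as ℤₚ
open import Data.Product using (_×_; _,_; proj₁; proj₂)
open import Data.Rational
open import Data.Rational.Properties
open import Relation.Binary.PropositionalEquality
  using (_≡_; refl; sym; cong; cong₂; subst; subst₂; trans; module ≡-Reasoning)

ℕ→ℚ-normal : ∀ a → ℕ→ℚ a ≡ mkℚ (ℤ.+ a) 0 (coprime-sym (1-coprimeTo a))
ℕ→ℚ-normal a = normalize-coprime (coprime-sym (1-coprimeTo a))

+*+ : ∀ m n → ℤ.+ m ℤ.* ℤ.+ n ≡ ℤ.+ (m ℕ.* n)
+*+ m n = ℤₚ.+◃n≡+n (m ℕ.* n)

ℕ→ℚ-suc : ∀ a → ℕ→ℚ (suc a) ≡ ℕ→ℚ a + 1ℚ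
ℕ→ℚ-suc a rewrite ℕ→ℚ-normal a | ℕₚ.*-identityʳ a | ℤₚ.+◃n≡+n a | ℕₚ.+-comm a 1 = refl

ℕ→ℚ-mono-≤ : ∀ {m n} → m ℕ.≤ n → ℕ→ℚ m ≤ ℕ→ℚ n
ℕ→ℚ-mono-≤ {m} {n} m≤n rewrite ℕ→ℚ-normal m | ℕ→ℚ-normal n =
  *≤* (subst₂ ℤ._≤_ (sym (+*+ m 1)) (sym (+*+ n 1)) (ℤ.+≤+ (ℕₚ.*-monoˡ-≤ 1 m≤n)))

reciprocal-inverse : ∀ k .{{_ : ℕ.NonZero k}} → ℕ→ℚ k * (ℤ.+ 1 / k) ≡ 1ℚ
reciprocal-inverse (suc k)
  rewrite ℕ→ℚ-normal (suc k) | normalize-coprime {1} {k} (1-coprimeTo _) =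
  *-inverseʳ (mkℚ (ℤ.+ suc k) 0 (coprime-sym (1-coprimeTo (suc k))))

quotient-unique : ∀ a n d .{{_ : ℕ.NonZero d}} →
                  a ℕ.* d ℕ.≤ n → n ℕ.< suc a ℕ.* d → n ℕ./ d ≡ a
quotient-unique a n d lower upper = ℕₚ.≤-antisym
  (ℕₚ.≤-pred (m<n*o⇒m/o<n upper))
  (subst (ℕ._≤ n ℕ./ d) (m*n/n≡m a d) (/-monoˡ-≤ d lower))

floor-unique : ∀ a p → ℕ→ℚ a ≤ p → p < ℕ→ℚ (suc a) → floor p ≡ ℤ.+ a
floor-unique a p rewrite ℕ→ℚ-normal a | ℕ→ℚ-normal (suc a) = by-cases p
  where
  by-cases : ∀ p → mkℚ (ℤ.+ a) 0 (coprime-sym (1-coprimeTo a)) ≤ p →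
             p < mkℚ (ℤ.+ suc a) 0 (coprime-sym (1-coprimeTo (suc a))) → floor p ≡ ℤ.+ a
  by-cases (mkℚ (ℤ.+ n) d-1 _) (*≤* lower) (*<* upper)
    rewrite +*+ a (suc d-1) | +*+ n 1 | +*+ (suc a) (suc d-1) | ℕₚ.*-identityʳ n
    = trans (ℤₚ.*-identityˡ (ℤ.+ (n ℕ./ suc d-1)))
        (cong ℤ.+_ (quotient-unique a n (suc d-1) (ℤₚ.drop‿+≤+ lower) (ℤₚ.drop‿+<+ upper)))
  -- a negative numerator cannot lie above a ≥ 0
  by-cases (mkℚ ℤ.-[1+ n ] d-1 _) (*≤* lower) _
    rewrite +*+ a (suc d-1) | ℤₚ.*-identityʳ ℤ.-[1+ n ] with lower
  ... | ()

module Expansion (k : ℕ) {{_ : ℕ.NonZero k}} {b : ℕ} (b<k : b ℕ.< k) where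

  Digit : Set
  Digit = Fin (suc b)

  ⟦_⟧ : List Digit → ℚ
  ⟦ l ⟧ = frac-enc k Fin→ℚ l

  K 1/K : ℚ
  K   = ℕ→ℚ k
  1/K = ℤ.+ 1 / k

  instance
    1/K-positive : Positive 1/K
    1/K-positive = normalize-pos 1 k
    1/K-nonNegative : NonNegative 1/K
    1/K-nonNegative = pos⇒nonNeg 1/K

  K*[X*1/K] : ∀ X → K * (X * 1/K) ≡ X
  K*[X*1/K] X = begin
    K * (X * 1/K)   ≡⟨ *-assoc K X 1/K ⟨
    K * X * 1/K     ≡⟨ cong (_* 1/K) (*-comm K X) ⟩
    X * K * 1/K     ≡⟨ *-assoc X K 1/K ⟩
    X * (K * 1/K)   ≡⟨ cong (X *_) (reciprocal-inverse k) ⟩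
    X * 1ℚ          ≡⟨ *-identityʳ X ⟩
    X               ∎
    where open ≡-Reasoning

  digit-lower : (a : Digit) (r : ℚ) → 0ℚ ≤ r → Fin→ℚ a ≤ Fin→ℚ a + r
  digit-lower a r 0≤r = subst (_≤ Fin→ℚ a + r) (+-identityʳ (Fin→ℚ a)) (+-monoʳ-≤ (Fin→ℚ a) 0≤r)

  digit-upper : (a : Digit) (r : ℚ) → r < 1ℚ → Fin→ℚ a + r < ℕ→ℚ (suc (toℕ a))
  digit-upper a r r<1 = subst (Fin→ℚ a + r <_) (sym (ℕ→ℚ-suc (toℕ a))) (+-monoʳ-< (Fin→ℚ a) r<1)

  floor-digit : (a : Digit) (r : ℚ) → 0ℚ ≤ r → r < 1ℚ → floor (Fin→ℚ a + r) ≡ ℤ.+ toℕ a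
  floor-digit a r 0≤r r<1 = floor-unique (toℕ a) _ (digit-lower a r 0≤r) (digit-upper a r r<1)

  expansion-bounds : ∀ l → 0ℚ ≤ ⟦ l ⟧ × ⟦ l ⟧ < 1ℚ
  expansion-bounds []      = ≤-refl , *<* (ℤ.+<+ (ℕ.s≤s ℕ.z≤n))
  expansion-bounds (a ∷ l) = nonneg , below-one
    where
    0≤⟦l⟧ : 0ℚ ≤ ⟦ l ⟧
    0≤⟦l⟧ = proj₁ (expansion-bounds l)
    ⟦l⟧<1 : ⟦ l ⟧ < 1ℚ
    ⟦l⟧<1 = proj₂ (expansion-bounds l)
    0≤a : 0ℚ ≤ Fin→ℚ a
    0≤a = ℕ→ℚ-mono-≤ {0} {toℕ a} ℕ.z≤n
    a+⟦l⟧<K : Fin→ℚ a + ⟦ l ⟧ < K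
    a+⟦l⟧<K = <-≤-trans (digit-upper a ⟦ l ⟧ ⟦l⟧<1)
                (ℕ→ℚ-mono-≤ (ℕₚ.≤-trans (Finₚ.toℕ<n a) b<k))
    nonneg : 0ℚ ≤ (Fin→ℚ a + ⟦ l ⟧) * 1/K
    nonneg = subst (_≤ (Fin→ℚ a + ⟦ l ⟧) * 1/K) (*-zeroˡ 1/K)
               (*-monoʳ-≤-nonNeg 1/K (≤-trans 0≤a (digit-lower a ⟦ l ⟧ 0≤⟦l⟧)))
    below-one : (Fin→ℚ a + ⟦ l ⟧) * 1/K < 1ℚ
    below-one = subst ((Fin→ℚ a + ⟦ l ⟧) * 1/K <_) (reciprocal-inverse k)
                  (*-monoˡ-<-pos 1/K a+⟦l⟧<K)

  scale-cons : ∀ a l → K * ⟦ a ∷ l ⟧ ≡ Fin→ℚ a + ⟦ l ⟧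
  scale-cons a l = K*[X*1/K] (Fin→ℚ a + ⟦ l ⟧)

  floor-scale-cons : ∀ a l → floor (K * ⟦ a ∷ l ⟧) ≡ ℤ.+ toℕ a
  floor-scale-cons a l = trans (cong floor (scale-cons a l))
    (floor-digit a ⟦ l ⟧ (proj₁ (expansion-bounds l)) (proj₂ (expansion-bounds l)))

  int-shift : ∀ l → int (K * ⟦ l ⟧) ≡ Fin→ℚ (hd Fin.zero l)
  int-shift []      = cong int (*-zeroʳ K)
  int-shift (a ∷ l) = cong (_/ 1) (floor-scale-cons a l)

  frac-shift : ∀ l → frac (K * ⟦ l ⟧) ≡ ⟦ tl l ⟧
  frac-shift []      = cong frac (*-zeroʳ K)
  frac-shift (a ∷ l) = begin
    K * ⟦ a ∷ l ⟧ - int (K * ⟦ a ∷ l ⟧)  ≡⟨ cong₂ _-_ (scale-cons a l) (int-shift (a ∷ l)) ⟩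
    Fin→ℚ a + ⟦ l ⟧ - Fin→ℚ a           ≡⟨ cong (_- Fin→ℚ a) (+-comm (Fin→ℚ a) ⟦ l ⟧) ⟩
    ⟦ l ⟧ + Fin→ℚ a - Fin→ℚ a           ≡⟨ +-assoc ⟦ l ⟧ (Fin→ℚ a) (- Fin→ℚ a) ⟩
    ⟦ l ⟧ + (Fin→ℚ a - Fin→ℚ a)         ≡⟨ cong (⟦ l ⟧ +_) (+-inverseʳ (Fin→ℚ a)) ⟩
    ⟦ l ⟧ + 0ℚ                          ≡⟨ +-identityʳ ⟦ l ⟧ ⟩
    ⟦ l ⟧                               ∎
    where open ≡-Reasoning

  push-digit : ∀ (a : Digit) l → (⟦ l ⟧ + Fin→ℚ a) * 1/K ≡ ⟦ a ∷ l ⟧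
  push-digit a l = cong (_* 1/K) (+-comm ⟦ l ⟧ (Fin→ℚ a))

choose-select : ∀ (w : Bool) a c → (1ℚ - Bool→ℚ w) * a + Bool→ℚ w * c ≡ (if w then c else a)
choose-select false a c rewrite *-identityˡ a | *-zeroˡ c = +-identityʳ a
choose-select true  a c rewrite *-identityˡ c | *-zeroˡ a = +-identityˡ c

module Simulation (M : TM) (L₁ L₂ L₃ : ℚ → ℚ → ℚ)
    (L₁-interpolates : Interpolates M L₁ (λ q s → Fin→ℚ (TM.δ₁ M q s)))
    (L₂-interpolates : Interpolates M L₂ (λ q s → Fin→ℚ (TM.δ₂ M q s)))
    (L₃-interpolates : Interpolates M L₃ (λ q s → Bool→ℚ (TM.δ₃ M q s))) where

  open TM M using (j; k; δ₂; δ₃)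
  open Expansion k (ℕₚ.m<n⇒m<1+n (ℕₚ.n<1+n j))

  choose-at : Fin (TM.m M) → TM.Σ M → ℚ → ℚ → ℚ
  choose-at q s a c = (1ℚ - L₃ (Fin→ℚ q) (Fin→ℚ s)) * a + L₃ (Fin→ℚ q) (Fin→ℚ s) * c

  choose-follows-move : ∀ {q s w} → δ₃ q s ≡ w → ∀ a c → choose-at q s a c ≡ (if w then c else a)
  choose-follows-move {q} {s} refl a c = begin
    choose-at q s a c
      ≡⟨ cong (λ t → (1ℚ - t) * a + t * c) (L₃-interpolates q s) ⟩
    (1ℚ - Bool→ℚ (δ₃ q s)) * a + Bool→ℚ (δ₃ q s) * c
      ≡⟨ choose-select (δ₃ q s) a c ⟩
    (if δ₃ q s then c else a) ∎
    where open ≡-Reasoning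

  write-digit : ∀ q s l → (⟦ l ⟧ + L₂ (Fin→ℚ q) (Fin→ℚ s)) * 1/K ≡ ⟦ δ₂ q s ∷ l ⟧
  write-digit q s l = trans (cong (λ d → (⟦ l ⟧ + d) * 1/K) (L₂-interpolates q s)) (push-digit (δ₂ q s) l)

  componentwise : {a b c d a′ b′ c′ d′ : ℚ} →
                  a ≡ a′ → b ≡ b′ → c ≡ c′ → d ≡ d′ → (a , b , c , d) ≡ (a′ , b′ , c′ , d′)
  componentwise refl refl refl refl = refl

  step-simulates-move : ∀ x s y q w → δ₃ q s ≡ w →
    step M L₁ L₂ L₃ (encode M (x , s , y , q)) ≡ encode M (move M w (x , s , y , q))
  step-simulates-move x s y q false moves-left = componentwise
    (trans (pick _ _) (frac-shift x))
    (trans (pick _ _) (int-shift x))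
    (trans (pick _ _) (write-digit q s y))
    (L₁-interpolates q s)
    where
    pick : ∀ a c → choose-at q s a c ≡ a
    pick = choose-follows-move moves-left
  step-simulates-move x s y q true moves-right = componentwise
    (trans (pick _ _) (write-digit q s x))
    (trans (pick _ _) (int-shift y))
    (trans (pick _ _) (frac-shift y))
    (L₁-interpolates q s)
    where
    pick : ∀ a c → choose-at q s a c ≡ c
    pick = choose-follows-move moves-right

  step-simulates-next : ∀ c → step M L₁ L₂ L₃ (encode M c) ≡ encode M (next M c)
  step-simulates-next (x , s , y , q) = step-simulates-move x s y q (δ₃ q s) refl

lemma12 : (M : TM) (L₁ L₂ L₃ : ℚ → ℚ → ℚ)
    → Interpolates M L₁ (λ q s → Fin→ℚ (TM.δ₁ M q s))
    → Interpolates M L₂ (λ q s → Fin→ℚ (TM.δ₂ M q s))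
    → Interpolates M L₃ (λ q s → Bool→ℚ (TM.δ₃ M q s))
    → (c₀ : Config M) (n : ℕ)
    → encode M (run M n c₀) ≡ iter (step M L₁ L₂ L₃) n (encode M c₀)
lemma12 M L₁ L₂ L₃ h₁ h₂ h₃ c₀ zero    = refl
lemma12 M L₁ L₂ L₃ h₁ h₂ h₃ c₀ (suc n) = begin
  encode M (next M (run M n c₀))                  ≡⟨ step-simulates-next (run M n c₀) ⟨
  step M L₁ L₂ L₃ (encode M (run M n c₀))         ≡⟨ cong (step M L₁ L₂ L₃) (lemma12 M L₁ L₂ L₃ h₁ h₂ h₃ c₀ n) ⟩
  step M L₁ L₂ L₃ (iter (step M L₁ L₂ L₃) n (encode M c₀)) ∎
  where
  open ≡-Reasoning
  open Simulation M L₁ L₂ L₃ h₁ h₂ h₃
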